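{- Let $c\ge 3$, $b\ge 1$ be integers. Then $b+c$ is an eigenvalue of the clique $2$-down Laplacian $\delta_1\delta_1^T$ of $G_{c,b}$ with multiplicity at least $\binom{c}{2}$.
   Context: $G_{c,b}$ is the graph on vertex set $\{1,\dots,b+c\}$ (natural order) with edges $\{i,j\}$ for $1\le i<j\le c$ and $\{i,j\}$ for $c+1\le i\le c+b$, $1\le j\le c$; $\mathcal T_{c,b}$ is the set of all triangles of $G_{c,b}$. For $T=\{p,q,r\}$ with $p<q<r$ and an edge $e$, $[T:e]$ is $1$ if $e=\{p,q\}$ or $\{q,r\}$, $-1$ if $e=\{p,r\}$, $0$ if $e\not\subset T$; $\delta_1$ is the $\mathcal T_{c,b}\times E(G_{c,b})$ matrix with entries $[T:e]$. -}

module Defs where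

open import Data.Bool using (Bool; true; false; _∧_; _∨_; if_then_else_)
open import Data.Nat using (ℕ; zero; suc; _+_; _≤ᵇ_; _<ᵇ_; _≡ᵇ_)
open import Data.Integer as ℤ using (ℤ)
open import Data.Rational as ℚ using (ℚ)
open import Data.List using (List; []; _∷_; map; concatMap; filter; length; upTo; lookup)
open import Data.Fin using (Fin)
open import Data.Product using (_×_; _,_)
open import Relation.Binary.PropositionalEquality using (_≡_)
open import Relation.Nullary.Decidable using (T?)

vertices : ℕ → ℕ → List ℕ
vertices c b = map suc (upTo (b + c))

-- Adjacency in G_{c,b} for an (ordered) pair x < y, exactly as in the paper:
-- {i,j} with 1 ≤ i < j ≤ c, or {i,j} with c+1 ≤ i ≤ c+b and 1 ≤ j ≤ c.
edgeB : ℕ → ℕ → ℕ → ℕ → Bool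
edgeB c b x y =
  (1 ≤ᵇ x) ∧ (x <ᵇ y) ∧
  ((y ≤ᵇ c) ∨ ((x ≤ᵇ c) ∧ (c <ᵇ y) ∧ (y ≤ᵇ c + b)))

edgeList : ℕ → ℕ → List (ℕ × ℕ)
edgeList c b =
  filter (λ e → T? (edgeB c b (Data.Product.proj₁ e) (Data.Product.proj₂ e)))
    (concatMap (λ x → map (λ y → (x , y)) (vertices c b)) (vertices c b))

triangleList : ℕ → ℕ → List (ℕ × ℕ × ℕ)
triangleList c b =
  filter (λ t → let p = Data.Product.proj₁ t
                    q = Data.Product.proj₁ (Data.Product.proj₂ t)
                    r = Data.Product.proj₂ (Data.Product.proj₂ t)
                in T? (edgeB c b p q ∧ edgeB c b q r ∧ edgeB c b p r))
    (concatMap (λ p → concatMap (λ q → map (λ r → (p , q , r)) (vertices c b))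
                                (vertices c b))
               (vertices c b))

nTri : ℕ → ℕ → ℕ
nTri c b = length (triangleList c b)

nEdge : ℕ → ℕ → ℕ
nEdge c b = length (edgeList c b)

incidence : ℕ × ℕ × ℕ → ℕ × ℕ → ℤ
incidence (p , q , r) (x , y) =
  if ((x ≡ᵇ p) ∧ (y ≡ᵇ q)) ∨ ((x ≡ᵇ q) ∧ (y ≡ᵇ r)) then ℤ.+ 1
  else if (x ≡ᵇ p) ∧ (y ≡ᵇ r) then ℤ.- (ℤ.+ 1)
  else ℤ.+ 0

δ₁ : (c b : ℕ) → Fin (nTri c b) → Fin (nEdge c b) → ℤ
δ₁ c b i e = incidence (lookup (triangleList c b) i) (lookup (edgeList c b) e)

sumℤ : (n : ℕ) → (Fin n → ℤ) → ℤ
sumℤ zero f = ℤ.+ 0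
sumℤ (suc n) f = f Fin.zero ℤ.+ sumℤ n (λ i → f (Fin.suc i))
  where import Data.Fin as Fin

sumℚ : (n : ℕ) → (Fin n → ℚ) → ℚ
sumℚ zero f = ℚ.0ℚ
sumℚ (suc n) f = f Fin.zero ℚ.+ sumℚ n (λ i → f (Fin.suc i))
  where import Data.Fin as Fin

downLaplacian : (c b : ℕ) → Fin (nTri c b) → Fin (nTri c b) → ℤ
downLaplacian c b i j = sumℤ (nEdge c b) (λ e → δ₁ c b i e ℤ.* δ₁ c b j e)

TriVec : ℕ → ℕ → Set
TriVec c b = Fin (nTri c b) → ℚ

InEigenspace : (c b : ℕ) → ℚ → TriVec c b → Set
InEigenspace c b λ' v =
  ∀ i → sumℚ (nTri c b) (λ j → (downLaplacian c b i j ℚ./ 1) ℚ.* v j) ≡ λ' ℚ.* v i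

LinearlyIndependent : (c b k : ℕ) → (Fin k → TriVec c b) → Set
LinearlyIndependent c b k vs =
  (a : Fin k → ℚ) →
  (∀ i → sumℚ k (λ m → a m ℚ.* vs m i) ≡ ℚ.0ℚ) →
  ∀ m → a m ≡ ℚ.0ℚ

module Submission where

-- For a clique edge f = (i , j), i < j ≤ c, take v_f = δ₁ e_f, the column of δ₁ at f.  Then
-- δ₁δ₁ᵀ v_f = δ₁ (δ₁ᵀδ₁ e_f), and (δ₁ᵀδ₁ e_f)(x , y) is a sum over the triangles on the edge
-- (x , y), i.e. over their third vertices z.  Because i and j are adjacent to every vertex, every
-- triple {i , j , z} is a triangle, so the z-term equals δχ(x , y , z), where χ = e_f − e_fᵀ is
-- the antisymmetrised indicator of f.  Applying δ₁ and summing over the three edges of a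
-- triangle t, the cocycle identity δδχ = 0 turns the z-term into δχ(t) = v_f(t) for every one
-- of the b + c vertices z.  The v_f are independent: the triangle (i , j , c + 1) contains the
-- clique edge f and no other one.

open import Defs

module DownLaplacian where

  open import Data.Bool using (Bool; true; false; T; _∧_; _∨_; if_then_else_)
  open import Data.Bool.Properties using (T-∧; T-∨)
  open import Data.Empty using (⊥; ⊥-elim)
  open import Data.Fin using (Fin; zero; suc; toℕ; splitAt; join; cast)
  import Data.Fin.Properties as Fin
  open import Data.Integer as ℤ using (ℤ; +_; _+_; _-_; _*_; -_; 0ℤ; 1ℤ)
  import Data.Integer.Properties as ℤ
  open import Data.Integer.Tactic.RingSolver using (solve-∀)
  open import Data.List using (List; []; _∷_; _++_; map; concatMap; filter; length; upTo; lookup)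
  open import Data.List.Membership.Propositional using (_∈_)
  open import Data.List.Membership.Propositional.Properties
    using (∈-map⁺; ∈-map⁻; ∈-upTo⁺; ∈-upTo⁻; ∈-concatMap⁺; ∈-filter⁺; ∈-filter⁻; ∈-lookup)
  open import Data.List.Properties using (length-map; length-upTo)
  open import Data.List.Relation.Unary.All as All using (All)
  open import Data.List.Relation.Unary.Any as Any using (here; there)
  open import Data.List.Relation.Unary.Any.Properties using (lookup-index)
  open import Data.List.Relation.Unary.Unique.Propositional using (Unique; _∷_)
  import Data.List.Relation.Unary.Unique.Propositional.Properties as Unique
  open import Data.Nat as ℕ using (ℕ; zero; suc; _≤_; _<_; _≡ᵇ_; s≤s; z≤n)
  open import Data.Nat.Combinatorics using (_C_; nC1≡n; nCk+nC[k+1]≡[n+1]C[k+1])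
  import Data.Nat.Properties as ℕ
  open import Data.Product using (_×_; _,_; proj₁; proj₂)
  open import Data.Rational as ℚ using (ℚ; _/_; 0ℚ; 1ℚ; toℚᵘ)
  import Data.Rational.Properties as ℚ
  open import Data.Rational.Unnormalised as ℚᵘ using (mkℚᵘ; *≡*) renaming (_≃_ to _≃ᵘ_)
  import Data.Rational.Unnormalised.Properties as ℚᵘ
  open import Data.Sum using (_⊎_; inj₁; inj₂; [_,_]′)
  open import Function using (_∘_; flip)
  open import Function.Bundles using (module Equivalence)
  open Equivalence using (to; from)
  open import Relation.Binary.Definitions using (tri<; tri≈; tri>)
  open import Relation.Binary.PropositionalEquality
  open import Relation.Nullary using (¬_; yes; no)
  open import Relation.Nullary.Decidable using (T?)

  private variable
    A B : Set

  ⟦_⟧ : Bool → ℤ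
  ⟦ true  ⟧ = 1ℤ
  ⟦ false ⟧ = 0ℤ

  ⟦⟧-true : ∀ {a} → T a → ⟦ a ⟧ ≡ 1ℤ
  ⟦⟧-true {true} _ = refl

  ⟦⟧-false : ∀ {a} → ¬ T a → ⟦ a ⟧ ≡ 0ℤ
  ⟦⟧-false {true}  ¬a = ⊥-elim (¬a _)
  ⟦⟧-false {false} _  = refl

  ⟦⟧-absorb : ∀ {a b} → (T b → T a) → ⟦ a ⟧ * ⟦ b ⟧ ≡ ⟦ b ⟧
  ⟦⟧-absorb {a} {false} _   = ℤ.*-zeroʳ ⟦ a ⟧
  ⟦⟧-absorb {a} {true}  b⇒a = cong (_* 1ℤ) (⟦⟧-true (b⇒a _))

  ∑ : List A → (A → ℤ) → ℤ
  ∑ []       f = 0ℤ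
  ∑ (x ∷ xs) f = f x + ∑ xs f

  infix 10 ∑
  syntax ∑ xs (λ x → e) = ∑[ x ∈ xs ] e

  ∑-cong : ∀ (xs : List A) {f g} → (∀ {x} → x ∈ xs → f x ≡ g x) → ∑ xs f ≡ ∑ xs g
  ∑-cong []       eq = refl
  ∑-cong (x ∷ xs) eq = cong₂ _+_ (eq (here refl)) (∑-cong xs (eq ∘ there))

  ∑-const : ∀ (xs : List A) k → ∑[ _ ∈ xs ] k ≡ + length xs * k
  ∑-const []       k = sym (ℤ.*-zeroˡ k)
  ∑-const (x ∷ xs) k = trans (cong (_+_ k) (∑-const xs k)) (sym (ℤ.suc-* (+ length xs) k))

  ∑-zero : ∀ (xs : List A) {f} → (∀ {x} → x ∈ xs → f x ≡ 0ℤ) → ∑ xs f ≡ 0ℤ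
  ∑-zero xs eq = trans (∑-cong xs eq) (trans (∑-const xs 0ℤ) (ℤ.*-zeroʳ (+ length xs)))

  ∑-++ : ∀ (xs ys : List A) f → ∑ (xs ++ ys) f ≡ ∑ xs f + ∑ ys f
  ∑-++ []       ys f = sym (ℤ.+-identityˡ (∑ ys f))
  ∑-++ (x ∷ xs) ys f = trans (cong (_+_ (f x)) (∑-++ xs ys f)) (sym (ℤ.+-assoc (f x) _ _))

  ∑-concatMap : ∀ (g : A → List B) xs f → ∑ (concatMap g xs) f ≡ ∑[ x ∈ xs ] ∑ (g x) f
  ∑-concatMap g []       f = refl
  ∑-concatMap g (x ∷ xs) f = trans (∑-++ (g x) _ f) (cong (_+_ (∑ (g x) f)) (∑-concatMap g xs f))

  ∑-map : ∀ (g : A → B) xs f → ∑ (map g xs) f ≡ ∑ xs (f ∘ g)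
  ∑-map g []       f = refl
  ∑-map g (x ∷ xs) f = cong (_+_ (f (g x))) (∑-map g xs f)

  ∑-filter : ∀ (P : A → Bool) xs f → ∑ (filter (T? ∘ P) xs) f ≡ ∑[ x ∈ xs ] (⟦ P x ⟧ * f x)
  ∑-filter P []       f = refl
  ∑-filter P (x ∷ xs) f with P x
  ... | true  = cong₂ _+_ (sym (ℤ.*-identityˡ (f x))) (∑-filter P xs f)
  ... | false = trans (∑-filter P xs f) (sym (ℤ.+-identityˡ _))

  ∑-distrib-+ : ∀ (xs : List A) f g → ∑[ x ∈ xs ] (f x + g x) ≡ ∑ xs f + ∑ xs g
  ∑-distrib-+ []       f g = refl
  ∑-distrib-+ (x ∷ xs) f g =
    trans (cong (_+_ (f x + g x)) (∑-distrib-+ xs f g)) (ring (f x) (g x) (∑ xs f) (∑ xs g))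
    where
    ring : ∀ a b c d → a + b + (c + d) ≡ a + c + (b + d)
    ring = solve-∀

  ∑-distrib-+- : ∀ (xs : List A) f g h → ∑[ x ∈ xs ] (f x + g x - h x) ≡ ∑ xs f + ∑ xs g - ∑ xs h
  ∑-distrib-+- []       f g h = refl
  ∑-distrib-+- (x ∷ xs) f g h =
    trans (cong (_+_ (f x + g x - h x)) (∑-distrib-+- xs f g h))
          (ring (f x) (g x) (h x) (∑ xs f) (∑ xs g) (∑ xs h))
    where
    ring : ∀ a b c d e f → a + b - c + (d + e - f) ≡ a + d + (b + e) - (c + f)
    ring = solve-∀

  ∑∑-distrib-+- : ∀ (xs : List A) (ys : List B) (F G H : A → B → ℤ) →
                  ∑[ x ∈ xs ] ∑[ y ∈ ys ] (F x y + G x y - H x y) ≡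
                  ∑[ x ∈ xs ] ∑[ y ∈ ys ] F x y + ∑[ x ∈ xs ] ∑[ y ∈ ys ] G x y
                    - ∑[ x ∈ xs ] ∑[ y ∈ ys ] H x y
  ∑∑-distrib-+- xs ys F G H =
    trans (∑-cong xs (λ {x} _ → ∑-distrib-+- ys (F x) (G x) (H x)))
          (∑-distrib-+- xs (λ x → ∑ ys (F x)) (λ x → ∑ ys (G x)) (λ x → ∑ ys (H x)))

  ∑-*ˡ : ∀ (xs : List A) k f → ∑[ x ∈ xs ] (k * f x) ≡ k * ∑ xs f
  ∑-*ˡ []       k f = sym (ℤ.*-zeroʳ k)
  ∑-*ˡ (x ∷ xs) k f = trans (cong (_+_ (k * f x)) (∑-*ˡ xs k f)) (sym (ℤ.*-distribˡ-+ k (f x) _))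

  ∑-*ʳ : ∀ (xs : List A) f k → ∑ xs f * k ≡ ∑[ x ∈ xs ] (f x * k)
  ∑-*ʳ []       f k = ℤ.*-zeroˡ k
  ∑-*ʳ (x ∷ xs) f k = trans (ℤ.*-distribʳ-+ k (f x) (∑ xs f)) (cong (_+_ (f x * k)) (∑-*ʳ xs f k))

  ∑-comm : ∀ (xs : List A) (ys : List B) (F : A → B → ℤ) →
           ∑[ x ∈ xs ] ∑[ y ∈ ys ] F x y ≡ ∑[ y ∈ ys ] ∑[ x ∈ xs ] F x y
  ∑-comm []       ys F = sym (∑-zero ys (λ _ → refl))
  ∑-comm (x ∷ xs) ys F = trans (cong (_+_ (∑ ys (F x))) (∑-comm xs ys F))
                               (sym (∑-distrib-+ ys (F x) (λ y → ∑[ x ∈ xs ] F x y)))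

  ∑-∑-assoc : ∀ (xs : List A) (ys : List B) (u : B → ℤ) (v : A → B → ℤ) (w : A → ℤ) →
              ∑[ x ∈ xs ] (∑[ y ∈ ys ] (u y * v x y) * w x) ≡ ∑[ y ∈ ys ] (u y * ∑[ x ∈ xs ] (v x y * w x))
  ∑-∑-assoc xs ys u v w = begin
    ∑[ x ∈ xs ] (∑[ y ∈ ys ] (u y * v x y) * w x)
      ≡⟨ ∑-cong xs (λ {x} _ → trans (∑-*ʳ ys (λ y → u y * v x y) (w x))
                                    (∑-cong ys (λ {y} _ → ℤ.*-assoc (u y) (v x y) (w x)))) ⟩
    ∑[ x ∈ xs ] ∑[ y ∈ ys ] (u y * (v x y * w x))
      ≡⟨ ∑-comm xs ys _ ⟩
    ∑[ y ∈ ys ] ∑[ x ∈ xs ] (u y * (v x y * w x))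
      ≡⟨ ∑-cong ys (λ {y} _ → ∑-*ˡ xs (u y) (λ x → v x y * w x)) ⟩
    ∑[ y ∈ ys ] (u y * ∑[ x ∈ xs ] (v x y * w x)) ∎
    where open ≡-Reasoning

  ∑-select : ∀ {xs : List A} {a f} → Unique xs → a ∈ xs →
             (∀ {x} → x ∈ xs → x ≢ a → f x ≡ 0ℤ) → ∑ xs f ≡ f a
  ∑-select {xs = x ∷ xs} {f = f} (x∉xs ∷ _) (here refl) off =
    trans (cong (_+_ (f x)) (∑-zero xs (λ y∈xs → off (there y∈xs) (All.lookup x∉xs y∈xs ∘ sym))))
          (ℤ.+-identityʳ (f x))
  ∑-select {xs = x ∷ xs} {f = f} (x∉xs ∷ u) (there a∈xs) off =
    trans (cong₂ _+_ (off (here refl) (All.lookup x∉xs a∈xs)) (∑-select u a∈xs (off ∘ there)))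
          (ℤ.+-identityˡ _)

  ∑∑-select : ∀ {xs : List A} {ys : List B} {a b} {F : A → B → ℤ} →
              Unique xs → Unique ys → a ∈ xs → b ∈ ys →
              (∀ {x y} → x ∈ xs → y ∈ ys → (x , y) ≢ (a , b) → F x y ≡ 0ℤ) →
              ∑[ x ∈ xs ] ∑[ y ∈ ys ] F x y ≡ F a b
  ∑∑-select {ys = ys} uxs uys a∈xs b∈ys off =
    trans (∑-select uxs a∈xs (λ x∈xs x≢a → ∑-zero ys (λ y∈ys → off x∈xs y∈ys (x≢a ∘ cong proj₁))))
          (∑-select uys b∈ys (λ y∈ys y≢b → off a∈xs y∈ys (y≢b ∘ cong proj₂)))

  fromℤ : ℤ → ℚ
  fromℤ x = x / 1

  toℚᵘ-fromℤ : ∀ x → toℚᵘ (fromℤ x) ≃ᵘ mkℚᵘ x 0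
  toℚᵘ-fromℤ x = ℚ.toℚᵘ-fromℚᵘ (mkℚᵘ x 0)

  fromℤ-+ : ∀ x y → fromℤ x ℚ.+ fromℤ y ≡ fromℤ (x + y)
  fromℤ-+ x y = ℚ.toℚᵘ-injective (begin
    toℚᵘ (fromℤ x ℚ.+ fromℤ y)          ≈⟨ ℚ.toℚᵘ-homo-+ (fromℤ x) (fromℤ y) ⟩
    toℚᵘ (fromℤ x) ℚᵘ.+ toℚᵘ (fromℤ y)  ≈⟨ ℚᵘ.+-cong (toℚᵘ-fromℤ x) (toℚᵘ-fromℤ y) ⟩
    mkℚᵘ x 0 ℚᵘ.+ mkℚᵘ y 0              ≈⟨ *≡* (ring x y) ⟩
    mkℚᵘ (x + y) 0                      ≈⟨ toℚᵘ-fromℤ (x + y) ⟨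
    toℚᵘ (fromℤ (x + y))                ∎)
    where
    open ℚᵘ.≃-Reasoning
    ring : ∀ x y → (x * + 1 + y * + 1) * + 1 ≡ (x + y) * (+ 1 * + 1)
    ring = solve-∀

  fromℤ-* : ∀ x y → fromℤ x ℚ.* fromℤ y ≡ fromℤ (x * y)
  fromℤ-* x y = ℚ.toℚᵘ-injective (begin
    toℚᵘ (fromℤ x ℚ.* fromℤ y)          ≈⟨ ℚ.toℚᵘ-homo-* (fromℤ x) (fromℤ y) ⟩
    toℚᵘ (fromℤ x) ℚᵘ.* toℚᵘ (fromℤ y)  ≈⟨ ℚᵘ.*-cong (toℚᵘ-fromℤ x) (toℚᵘ-fromℤ y) ⟩
    mkℚᵘ x 0 ℚᵘ.* mkℚᵘ y 0              ≈⟨ *≡* (ring x y) ⟩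
    mkℚᵘ (x * y) 0                      ≈⟨ toℚᵘ-fromℤ (x * y) ⟨
    toℚᵘ (fromℤ (x * y))                ∎)
    where
    open ℚᵘ.≃-Reasoning
    ring : ∀ x y → x * y * + 1 ≡ x * y * (+ 1 * + 1)
    ring = solve-∀

  sumℚ-fromℤ-* : ∀ n (g h : Fin n → ℤ) →
                 sumℚ n (λ k → fromℤ (g k) ℚ.* fromℤ (h k)) ≡ fromℤ (sumℤ n (λ k → g k * h k))
  sumℚ-fromℤ-* zero    g h = refl
  sumℚ-fromℤ-* (suc n) g h =
    trans (cong₂ ℚ._+_ (fromℤ-* (g zero) (h zero)) (sumℚ-fromℤ-* n (g ∘ suc) (h ∘ suc)))
          (fromℤ-+ (g zero * h zero) _)

  sumℚ-zero : ∀ n (g : Fin n → ℚ) → (∀ k → g k ≡ 0ℚ) → sumℚ n g ≡ 0ℚ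
  sumℚ-zero zero    g g≡0 = refl
  sumℚ-zero (suc n) g g≡0 =
    trans (cong₂ ℚ._+_ (g≡0 zero) (sumℚ-zero n (g ∘ suc) (g≡0 ∘ suc))) (ℚ.+-identityˡ 0ℚ)

  sumℚ-select : ∀ n (g : Fin n → ℚ) k → (∀ m → m ≢ k → g m ≡ 0ℚ) → sumℚ n g ≡ g k
  sumℚ-select (suc n) g zero    off =
    trans (cong (g zero ℚ.+_) (sumℚ-zero n (g ∘ suc) (λ m → off (suc m) (λ ()))))
          (ℚ.+-identityʳ (g zero))
  sumℚ-select (suc n) g (suc k) off =
    trans (cong₂ ℚ._+_ (off zero (λ ()))
                       (sumℚ-select n (g ∘ suc) k (λ m m≢k → off (suc m) (m≢k ∘ Fin.suc-injective))))
          (ℚ.+-identityˡ (g (suc k)))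

  sumℤ-lookup : ∀ (xs : List A) g → sumℤ (length xs) (λ k → g (lookup xs k)) ≡ ∑ xs g
  sumℤ-lookup []       g = refl
  sumℤ-lookup (x ∷ xs) g = cong (_+_ (g x)) (sumℤ-lookup xs g)

  -- Incidence numbers as coboundaries

  infix 4 _≐_
  _≐_ : ℕ × ℕ → ℕ × ℕ → Bool
  (x , y) ≐ (p , q) = (x ≡ᵇ p) ∧ (y ≡ᵇ q)

  ≐⇒≡ : ∀ d e → T (d ≐ e) → d ≡ e
  ≐⇒≡ (x , y) (p , q) d≐e = let x≡ᵇp , y≡ᵇq = to T-∧ d≐e in
    cong₂ _,_ (ℕ.≡ᵇ⇒≡ x p x≡ᵇp) (ℕ.≡ᵇ⇒≡ y q y≡ᵇq)

  ⟦≐⟧-refl : ∀ e → ⟦ e ≐ e ⟧ ≡ 1ℤ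
  ⟦≐⟧-refl (x , y) = ⟦⟧-true (from T-∧ (ℕ.≡⇒≡ᵇ x x refl , ℕ.≡⇒≡ᵇ y y refl))

  ⟦≐⟧-≢ : ∀ {d e} → d ≢ e → ⟦ d ≐ e ⟧ ≡ 0ℤ
  ⟦≐⟧-≢ {d} {e} d≢e = ⟦⟧-false (d≢e ∘ ≐⇒≡ d e)

  if-as-sum : ∀ a b c → (T a → T b → ⊥) → (T a → T c → ⊥) → (T b → T c → ⊥) →
              (if a ∨ b then + 1 else if c then - (+ 1) else + 0) ≡ ⟦ a ⟧ + ⟦ b ⟧ - ⟦ c ⟧
  if-as-sum true  true  _     a#b _   _   = ⊥-elim (a#b _ _)
  if-as-sum true  false true  _   a#c _   = ⊥-elim (a#c _ _)
  if-as-sum false true  true  _   _   b#c = ⊥-elim (b#c _ _)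
  if-as-sum true  false false _   _   _   = refl
  if-as-sum false true  false _   _   _   = refl
  if-as-sum false false true  _   _   _   = refl
  if-as-sum false false false _   _   _   = refl

  incidence-≐ : ∀ {p q r} e → p ≢ q → q ≢ r →
                incidence (p , q , r) e ≡ ⟦ e ≐ (p , q) ⟧ + ⟦ e ≐ (q , r) ⟧ - ⟦ e ≐ (p , r) ⟧
  incidence-≐ {p} {q} {r} e@(x , y) p≢q q≢r = if-as-sum (e ≐ (p , q)) (e ≐ (q , r)) (e ≐ (p , r))
    (λ pq qr → p≢q (cong proj₁ (trans (sym (≐⇒≡ e _ pq)) (≐⇒≡ e _ qr))))
    (λ pq pr → q≢r (cong proj₂ (trans (sym (≐⇒≡ e _ pq)) (≐⇒≡ e _ pr))))
    (λ qr pr → p≢q (cong proj₁ (trans (sym (≐⇒≡ e _ pr)) (≐⇒≡ e _ qr))))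

  incidence-off-apex : ∀ {p q r} e → p ≢ q → q ≢ r → proj₂ e ≢ r →
                       incidence (p , q , r) e ≡ ⟦ e ≐ (p , q) ⟧
  incidence-off-apex {p} {q} {r} e p≢q q≢r y≢r = begin
    incidence (p , q , r) e
      ≡⟨ incidence-≐ e p≢q q≢r ⟩
    ⟦ e ≐ (p , q) ⟧ + ⟦ e ≐ (q , r) ⟧ - ⟦ e ≐ (p , r) ⟧
      ≡⟨ cong₂ _-_ (cong (_+_ ⟦ e ≐ (p , q) ⟧) (⟦≐⟧-≢ {e} {q , r} (y≢r ∘ cong proj₂)))
                   (⟦≐⟧-≢ {e} {p , r} (y≢r ∘ cong proj₂)) ⟩
    ⟦ e ≐ (p , q) ⟧ + 0ℤ - 0ℤ
      ≡⟨ ring ⟦ e ≐ (p , q) ⟧ ⟩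
    ⟦ e ≐ (p , q) ⟧ ∎
    where
    open ≡-Reasoning
    ring : ∀ a → a + 0ℤ - 0ℤ ≡ a
    ring = solve-∀

  masked-incidence : ∀ m {p q r} e g → (T m → p ≢ q × q ≢ r) →
                     ⟦ m ⟧ * (incidence (p , q , r) e * g) ≡
                     ⟦ e ≐ (p , q) ⟧ * (⟦ m ⟧ * g) + ⟦ e ≐ (q , r) ⟧ * (⟦ m ⟧ * g)
                       - ⟦ e ≐ (p , r) ⟧ * (⟦ m ⟧ * g)
  masked-incidence false {p} {q} {r} e g _ = ring ⟦ e ≐ (p , q) ⟧ ⟦ e ≐ (q , r) ⟧ ⟦ e ≐ (p , r) ⟧
    where
    ring : ∀ a b c → 0ℤ ≡ a * 0ℤ + b * 0ℤ - c * 0ℤ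
    ring = solve-∀
  masked-incidence true {p} {q} {r} e g distinct =
    trans (cong (λ i → 1ℤ * (i * g)) (incidence-≐ e (proj₁ (distinct _)) (proj₂ (distinct _))))
          (ring ⟦ e ≐ (p , q) ⟧ ⟦ e ≐ (q , r) ⟧ ⟦ e ≐ (p , r) ⟧ g)
    where
    ring : ∀ a b c g → 1ℤ * ((a + b - c) * g) ≡ a * (1ℤ * g) + b * (1ℤ * g) - c * (1ℤ * g)
    ring = solve-∀

  alt : (ℕ → ℕ → ℤ) → ℕ → ℕ → ℤ
  alt φ u v = φ u v - φ v u

  δalt : (ℕ → ℕ → ℤ) → ℕ → ℕ → ℕ → ℤ
  δalt φ x y z = alt φ x y + alt φ y z - alt φ x z

  module _ (φ : ℕ → ℕ → ℤ) where

    δalt-cocycle : ∀ p q r z → δalt φ p q z + δalt φ q r z - δalt φ p r z ≡ δalt φ p q r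
    δalt-cocycle p q r z = ring (alt φ p q) (alt φ q z) (alt φ p z) (alt φ q r) (alt φ r z) (alt φ p r)
      where
      ring : ∀ pq qz pz qr rz pr → pq + qz - pz + (qr + rz - qz) - (pr + rz - pz) ≡ pq + qr - pr
      ring = solve-∀

    δalt-rotate : ∀ x y z → δalt φ z x y ≡ δalt φ x y z
    δalt-rotate x y z = ring (φ x y) (φ y x) (φ y z) (φ z y) (φ x z) (φ z x)
      where
      ring : ∀ xy yx yz zy xz zx → (zx - xz) + (xy - yx) - (zy - yz) ≡ (xy - yx) + (yz - zy) - (xz - zx)
      ring = solve-∀

    δalt-swap : ∀ x y z → δalt φ x z y ≡ - δalt φ x y z
    δalt-swap x y z = ring (φ x y) (φ y x) (φ y z) (φ z y) (φ x z) (φ z x)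
      where
      ring : ∀ xy yx yz zy xz zx → (xz - zx) + (zy - yz) - (xy - yx) ≡ - ((xy - yx) + (yz - zy) - (xz - zx))
      ring = solve-∀

    δalt-diagˡ : ∀ x y → δalt φ x y x ≡ 0ℤ
    δalt-diagˡ x y = ring (φ x y) (φ y x) (φ x x)
      where
      ring : ∀ xy yx xx → (xy - yx) + (yx - xy) - (xx - xx) ≡ 0ℤ
      ring = solve-∀

    δalt-diagʳ : ∀ x y → δalt φ x y y ≡ 0ℤ
    δalt-diagʳ x y = ring (φ x y) (φ y x) (φ y y)
      where
      ring : ∀ xy yx yy → (xy - yx) + (yy - yy) - (xy - yx) ≡ 0ℤ
      ring = solve-∀

  ordered : ℕ → ℕ → ℕ → Bool
  ordered x y z = (x ℕ.<ᵇ y) ∧ (y ℕ.<ᵇ z)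

  ordered⇒< : ∀ x y z → T (ordered x y z) → x < y × y < z
  ordered⇒< x y z o = let x<y , y<z = to (T-∧ {x ℕ.<ᵇ y}) o in ℕ.<ᵇ⇒< x y x<y , ℕ.<ᵇ⇒< y z y<z

  <⇒ordered : ∀ {x y z} → x < y → y < z → T (ordered x y z)
  <⇒ordered {x} {y} x<y y<z = from (T-∧ {x ℕ.<ᵇ y}) (ℕ.<⇒<ᵇ x<y , ℕ.<⇒<ᵇ y<z)

  ⟦ordered⟧-false : ∀ x y z → ¬ (x < y × y < z) → ⟦ ordered x y z ⟧ ≡ 0ℤ
  ⟦ordered⟧-false x y z ¬x<y<z = ⟦⟧-false (¬x<y<z ∘ ordered⇒< x y z)

  exactly-one-position : ∀ {x y z} → x < y → z ≢ x → z ≢ y →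
                         ⟦ ordered x y z ⟧ + ⟦ ordered z x y ⟧ + ⟦ ordered x z y ⟧ ≡ 1ℤ
  exactly-one-position {x} {y} {z} x<y z≢x z≢y with ℕ.<-cmp z x
  ... | tri≈ _ z≡x _ = ⊥-elim (z≢x z≡x)
  ... | tri< z<x _ _ =
    cong₂ _+_ (cong₂ _+_ (⟦ordered⟧-false x y z (λ (_ , y<z) → ℕ.<-asym y<z (ℕ.<-trans z<x x<y)))
                         (⟦⟧-true (<⇒ordered z<x x<y)))
              (⟦ordered⟧-false x z y (λ (x<z , _) → ℕ.<-asym x<z z<x))
  ... | tri> _ _ x<z with ℕ.<-cmp z y
  ...   | tri≈ _ z≡y _ = ⊥-elim (z≢y z≡y)
  ...   | tri< z<y _ _ =
    cong₂ _+_ (cong₂ _+_ (⟦ordered⟧-false x y z (λ (_ , y<z) → ℕ.<-asym y<z z<y))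
                         (⟦ordered⟧-false z x y (λ (z<x , _) → ℕ.<-asym z<x x<z)))
              (⟦⟧-true (<⇒ordered x<z z<y))
  ...   | tri> _ _ y<z =
    cong₂ _+_ (cong₂ _+_ (⟦⟧-true (<⇒ordered x<y y<z))
                         (⟦ordered⟧-false z x y (λ (z<x , _) → ℕ.<-asym z<x x<z)))
              (⟦ordered⟧-false x z y (λ (_ , z<y) → ℕ.<-asym z<y y<z))

  isTriangle : ℕ → ℕ → ℕ × ℕ × ℕ → Bool
  isTriangle c b (p , q , r) = edgeB c b p q ∧ edgeB c b q r ∧ edgeB c b p r

  module Graph (c b : ℕ) where

    V : List ℕ
    V = vertices c b

    vertices-unique : Unique V
    vertices-unique = Unique.map⁺ ℕ.suc-injective (Unique.upTo⁺ (b ℕ.+ c))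

    ∈-vertices⁺ : ∀ {x} → 1 ≤ x → x ≤ b ℕ.+ c → x ∈ V
    ∈-vertices⁺ {suc x} _ x<N = ∈-map⁺ suc (∈-upTo⁺ x<N)

    ∈-vertices⁻ : ∀ {x} → x ∈ V → 1 ≤ x × x ≤ b ℕ.+ c
    ∈-vertices⁻ x∈V with k , k∈ , refl ← ∈-map⁻ suc x∈V = s≤s z≤n , ∈-upTo⁻ k∈

    length-vertices : length V ≡ b ℕ.+ c
    length-vertices = trans (length-map suc (upTo (b ℕ.+ c))) (length-upTo (b ℕ.+ c))

    edgeB-bounds : ∀ {x y} → T (edgeB c b x y) → 1 ≤ x × x < y × y ≤ b ℕ.+ c
    edgeB-bounds {x} {y} e =
      ℕ.≤ᵇ⇒≤ 1 x 1≤x , ℕ.<ᵇ⇒< x y x<y , subst (y ≤_) (ℕ.+-comm c b) (y≤c+b (to (T-∨ {y ℕ.≤ᵇ c}) y-adj))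
      where
      1≤x : T (1 ℕ.≤ᵇ x)
      1≤x = proj₁ (to (T-∧ {1 ℕ.≤ᵇ x}) e)
      x<y : T (x ℕ.<ᵇ y)
      x<y = proj₁ (to (T-∧ {x ℕ.<ᵇ y}) (proj₂ (to (T-∧ {1 ℕ.≤ᵇ x}) e)))
      y-adj : T ((y ℕ.≤ᵇ c) ∨ ((x ℕ.≤ᵇ c) ∧ (c ℕ.<ᵇ y) ∧ (y ℕ.≤ᵇ c ℕ.+ b)))
      y-adj = proj₂ (to (T-∧ {x ℕ.<ᵇ y}) (proj₂ (to (T-∧ {1 ℕ.≤ᵇ x}) e)))
      y≤c+b : T (y ℕ.≤ᵇ c) ⊎ T ((x ℕ.≤ᵇ c) ∧ (c ℕ.<ᵇ y) ∧ (y ℕ.≤ᵇ c ℕ.+ b)) → y ≤ c ℕ.+ b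
      y≤c+b (inj₁ y≤c) = ℕ.≤-trans (ℕ.≤ᵇ⇒≤ y c y≤c) (ℕ.m≤m+n c b)
      y≤c+b (inj₂ h)   = ℕ.≤ᵇ⇒≤ y (c ℕ.+ b) (proj₂ (to (T-∧ {c ℕ.<ᵇ y}) (proj₂ (to (T-∧ {x ℕ.≤ᵇ c}) h))))

    edgeB⇒∈ : ∀ x y → T (edgeB c b x y) → x ∈ V × y ∈ V
    edgeB⇒∈ x y e with 1≤x , x<y , y≤N ← edgeB-bounds {x} {y} e =
      ∈-vertices⁺ 1≤x (ℕ.≤-trans (ℕ.<⇒≤ x<y) y≤N) , ∈-vertices⁺ (ℕ.≤-trans 1≤x (ℕ.<⇒≤ x<y)) y≤N

    clique-adjacent : ∀ {x y} → x ∈ V → y ∈ V → x < y → x ≤ c ⊎ y ≤ c → T (edgeB c b x y)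
    clique-adjacent {x} {y} x∈V y∈V x<y x≤c⊎y≤c =
      from T-∧ (ℕ.≤⇒≤ᵇ (proj₁ (∈-vertices⁻ x∈V)) , from T-∧ (ℕ.<⇒<ᵇ x<y , from T-∨ (adjacent x≤c⊎y≤c)))
      where
      adjacent : x ≤ c ⊎ y ≤ c → T (y ℕ.≤ᵇ c) ⊎ T ((x ℕ.≤ᵇ c) ∧ (c ℕ.<ᵇ y) ∧ (y ℕ.≤ᵇ c ℕ.+ b))
      adjacent one-in-clique with y ℕ.≤? c | one-in-clique
      ... | yes y≤c | _        = inj₁ (ℕ.≤⇒≤ᵇ y≤c)
      ... | no  y≰c | inj₂ y≤c = ⊥-elim (y≰c y≤c)
      ... | no  y≰c | inj₁ x≤c = inj₂ (from T-∧ (ℕ.≤⇒≤ᵇ x≤c , from T-∧ (ℕ.<⇒<ᵇ (ℕ.≰⇒> y≰c) ,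
                                     ℕ.≤⇒≤ᵇ (subst (y ≤_) (ℕ.+-comm b c) (proj₂ (∈-vertices⁻ y∈V))))))

    triangle⇒edges : ∀ p q r → T (isTriangle c b (p , q , r)) →
                     T (edgeB c b p q) × T (edgeB c b q r) × T (edgeB c b p r)
    triangle⇒edges p q r t = let pq , qr∧pr = to (T-∧ {edgeB c b p q}) t in
      pq , to (T-∧ {edgeB c b q r}) qr∧pr

    triangle⇒< : ∀ p q r → T (isTriangle c b (p , q , r)) → p < q × q < r
    triangle⇒< p q r t = let pq , qr , _ = triangle⇒edges p q r t in
      proj₁ (proj₂ (edgeB-bounds {p} {q} pq)) , proj₁ (proj₂ (edgeB-bounds {q} {r} qr))

    triangle⇒≢ : ∀ p q r → T (isTriangle c b (p , q , r)) → p ≢ q × q ≢ r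
    triangle⇒≢ p q r t = let p<q , q<r = triangle⇒< p q r t in ℕ.<⇒≢ p<q , ℕ.<⇒≢ q<r

    triangle⇒∈ : ∀ p q r → T (isTriangle c b (p , q , r)) → p ∈ V × q ∈ V × r ∈ V
    triangle⇒∈ p q r t = let pq , qr , _ = triangle⇒edges p q r t in
      proj₁ (edgeB⇒∈ p q pq) , edgeB⇒∈ q r qr

    clique-triangle : ∀ {p q r} → p ∈ V → q ∈ V → r ∈ V → p < q → q < r →
                      (p ≤ c × q ≤ c) ⊎ (q ≤ c × r ≤ c) ⊎ (p ≤ c × r ≤ c) →
                      T (isTriangle c b (p , q , r))
    clique-triangle p∈V q∈V r∈V p<q q<r two = let pq , qr , pr = endpoint-in-clique two in
      from T-∧ (clique-adjacent p∈V q∈V p<q pq ,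
                from T-∧ (clique-adjacent q∈V r∈V q<r qr , clique-adjacent p∈V r∈V (ℕ.<-trans p<q q<r) pr))
      where
      endpoint-in-clique : ∀ {p q r} → (p ≤ c × q ≤ c) ⊎ (q ≤ c × r ≤ c) ⊎ (p ≤ c × r ≤ c) →
                           (p ≤ c ⊎ q ≤ c) × (q ≤ c ⊎ r ≤ c) × (p ≤ c ⊎ r ≤ c)
      endpoint-in-clique (inj₁ (p≤c , q≤c))        = inj₁ p≤c , inj₁ q≤c , inj₁ p≤c
      endpoint-in-clique (inj₂ (inj₁ (q≤c , r≤c))) = inj₂ q≤c , inj₁ q≤c , inj₂ r≤c
      endpoint-in-clique (inj₂ (inj₂ (p≤c , r≤c))) = inj₁ p≤c , inj₂ r≤c , inj₁ p≤c

    pairs : List (ℕ × ℕ)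
    pairs = concatMap (λ x → map (x ,_) V) V

    triples : List (ℕ × ℕ × ℕ)
    triples = concatMap (λ p → concatMap (λ q → map (λ r → p , q , r) V) V) V

    ∈-triangleList : ∀ {t} → T (isTriangle c b t) → t ∈ triangleList c b
    ∈-triangleList {p , q , r} t = ∈-filter⁺ (T? ∘ isTriangle c b)
      (∈-concatMap⁺ (λ p → concatMap (λ q → map (λ r → p , q , r) V) V)
        (Any.map (λ { refl → ∈-concatMap⁺ (λ q → map (λ r → p , q , r) V)
                               (Any.map (λ { refl → ∈-map⁺ (λ r → p , q , r) r∈V }) q∈V) }) p∈V))
      t
      where
      p∈V = proj₁ (triangle⇒∈ p q r t)
      q∈V = proj₁ (proj₂ (triangle⇒∈ p q r t))
      r∈V = proj₂ (proj₂ (triangle⇒∈ p q r t))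

    lookup-triangleList : ∀ k → T (isTriangle c b (lookup (triangleList c b) k))
    lookup-triangleList k =
      proj₂ (∈-filter⁻ (T? ∘ isTriangle c b) {xs = triples} (∈-lookup {xs = triangleList c b} k))

    sumℤ-downLaplacian : ∀ k (v : ℕ × ℕ × ℕ → ℤ) →
      let row = incidence (lookup (triangleList c b) k) in
      sumℤ (nTri c b) (λ k′ → downLaplacian c b k k′ * v (lookup (triangleList c b) k′)) ≡
      ∑[ t ∈ triangleList c b ] (∑[ e ∈ edgeList c b ] (row e * incidence t e) * v t)
    sumℤ-downLaplacian k v =
      trans (sumℤ-lookup TL (λ t → sumℤ (nEdge c b) (λ e → row (lookup EL e) * incidence t (lookup EL e))
                                   * v t))
            (∑-cong TL (λ {t} _ → cong (_* v t) (sumℤ-lookup EL (λ e → row e * incidence t e))))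
      where
      TL = triangleList c b
      EL = edgeList c b
      row = incidence (lookup TL k)

    ∑-edgeList : ∀ g → ∑ (edgeList c b) g ≡ ∑[ x ∈ V ] ∑[ y ∈ V ] (⟦ edgeB c b x y ⟧ * g (x , y))
    ∑-edgeList g =
      trans (∑-filter (λ e → edgeB c b (proj₁ e) (proj₂ e)) pairs g)
            (trans (∑-concatMap (λ x → map (x ,_) V) V G) (∑-cong V (λ {x} _ → ∑-map (x ,_) V G)))
      where
      G : ℕ × ℕ → ℤ
      G e = ⟦ edgeB c b (proj₁ e) (proj₂ e) ⟧ * g e

    ∑-triangleList : ∀ g → ∑ (triangleList c b) g ≡
                     ∑[ p ∈ V ] ∑[ q ∈ V ] ∑[ r ∈ V ] (⟦ isTriangle c b (p , q , r) ⟧ * g (p , q , r))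
    ∑-triangleList g =
      trans (∑-filter (isTriangle c b) triples g)
            (trans (∑-concatMap (λ p → concatMap (λ q → map (λ r → p , q , r) V) V) V G)
                   (∑-cong V (λ {p} _ → trans (∑-concatMap (λ q → map (λ r → p , q , r) V) V G)
                                              (∑-cong V (λ {q} _ → ∑-map (λ r → p , q , r) V G)))))
      where
      G : ℕ × ℕ × ℕ → ℤ
      G t = ⟦ isTriangle c b t ⟧ * g t

    ∑∑-collapse : ∀ {a b} (δ : ℕ × ℕ → ℤ) (K : ℕ → ℕ → ℤ) → a ∈ V → b ∈ V → δ (a , b) ≡ 1ℤ →
                  (∀ {e} → e ≢ (a , b) → δ e ≡ 0ℤ) →
                  ∑[ x ∈ V ] ∑[ y ∈ V ] (δ (x , y) * K x y) ≡ K a b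
    ∑∑-collapse {a} {b} δ K a∈V b∈V δ-at δ-off =
      trans (∑∑-select vertices-unique vertices-unique a∈V b∈V (λ _ _ ne → cong (_* K _ _) (δ-off ne)))
            (trans (cong (_* K a b) δ-at) (ℤ.*-identityˡ (K a b)))

    ∑-edgeList-incidence : ∀ {p q r} (h : ℕ × ℕ → ℤ) → T (isTriangle c b (p , q , r)) →
                           ∑[ e ∈ edgeList c b ] (incidence (p , q , r) e * h e) ≡
                           h (p , q) + h (q , r) - h (p , r)
    ∑-edgeList-incidence {p} {q} {r} h t = begin
      ∑[ e ∈ edgeList c b ] (incidence (p , q , r) e * h e)
        ≡⟨ ∑-edgeList _ ⟩
      ∑[ x ∈ V ] ∑[ y ∈ V ] (⟦ edgeB c b x y ⟧ * (incidence (p , q , r) (x , y) * h (x , y)))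
        ≡⟨ ∑-cong V (λ {x} _ → ∑-cong V (λ {y} _ →
             masked-incidence (edgeB c b x y) (x , y) (h (x , y)) (λ _ → triangle⇒≢ p q r t))) ⟩
      ∑[ x ∈ V ] ∑[ y ∈ V ] (δ (p , q) x y * K x y + δ (q , r) x y * K x y - δ (p , r) x y * K x y)
        ≡⟨ ∑∑-distrib-+- V V _ _ _ ⟩
      ∑[ x ∈ V ] ∑[ y ∈ V ] (δ (p , q) x y * K x y) + ∑[ x ∈ V ] ∑[ y ∈ V ] (δ (q , r) x y * K x y)
        - ∑[ x ∈ V ] ∑[ y ∈ V ] (δ (p , r) x y * K x y)
        ≡⟨ cong₂ _-_ (cong₂ _+_ (collapse p∈V q∈V) (collapse q∈V r∈V)) (collapse p∈V r∈V) ⟩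
      K p q + K q r - K p r
        ≡⟨ cong₂ _-_ (cong₂ _+_ (present {p} {q} pq) (present {q} {r} qr)) (present {p} {r} pr) ⟩
      h (p , q) + h (q , r) - h (p , r) ∎
      where
      open ≡-Reasoning
      K : ℕ → ℕ → ℤ
      K x y = ⟦ edgeB c b x y ⟧ * h (x , y)
      δ : ℕ × ℕ → ℕ → ℕ → ℤ
      δ e x y = ⟦ (x , y) ≐ e ⟧
      p∈V = proj₁ (triangle⇒∈ p q r t)
      q∈V = proj₁ (proj₂ (triangle⇒∈ p q r t))
      r∈V = proj₂ (proj₂ (triangle⇒∈ p q r t))
      pq = proj₁ (triangle⇒edges p q r t)
      qr = proj₁ (proj₂ (triangle⇒edges p q r t))
      pr = proj₂ (proj₂ (triangle⇒edges p q r t))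
      collapse : ∀ {x y} → x ∈ V → y ∈ V → ∑[ x′ ∈ V ] ∑[ y′ ∈ V ] (δ (x , y) x′ y′ * K x′ y′) ≡ K x y
      collapse {x} {y} x∈V y∈V = ∑∑-collapse (λ e → ⟦ e ≐ (x , y) ⟧) K x∈V y∈V (⟦≐⟧-refl (x , y)) ⟦≐⟧-≢
      present : ∀ {x y} → T (edgeB c b x y) → K x y ≡ h (x , y)
      present {x} {y} e = trans (cong (_* h (x , y)) (⟦⟧-true e)) (ℤ.*-identityˡ (h (x , y)))

    onTriangle : (ℕ × ℕ × ℕ → ℤ) → ℕ → ℕ → ℕ → ℤ
    onTriangle F p q r = ⟦ isTriangle c b (p , q , r) ⟧ * F (p , q , r)

    ∑-triangleList-incidence : ∀ {x y} (F : ℕ × ℕ × ℕ → ℤ) → x ∈ V → y ∈ V →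
      ∑[ t ∈ triangleList c b ] (incidence t (x , y) * F t) ≡
      ∑[ z ∈ V ] (onTriangle F x y z + onTriangle F z x y - onTriangle F x z y)
    ∑-triangleList-incidence {x} {y} F x∈V y∈V = begin
      ∑[ t ∈ triangleList c b ] (incidence t (x , y) * F t)
        ≡⟨ ∑-triangleList _ ⟩
      ∑[ p ∈ V ] ∑[ q ∈ V ] ∑[ r ∈ V ]
        (⟦ isTriangle c b (p , q , r) ⟧ * (incidence (p , q , r) (x , y) * F (p , q , r)))
        ≡⟨ ∑-cong V (λ {p} _ → ∑-cong V (λ {q} _ → ∑-cong V (λ {r} _ →
             masked-incidence (isTriangle c b (p , q , r)) (x , y) (F (p , q , r)) (triangle⇒≢ p q r)))) ⟩
      ∑[ p ∈ V ] ∑[ q ∈ V ] ∑[ r ∈ V ] (δ (p , q) * W p q r + δ (q , r) * W p q r - δ (p , r) * W p q r)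
        ≡⟨ trans (∑-cong V (λ {p} _ → ∑∑-distrib-+- V V _ _ _)) (∑-distrib-+- V _ _ _) ⟩
      ∑[ p ∈ V ] ∑[ q ∈ V ] ∑[ r ∈ V ] (δ (p , q) * W p q r)
        + ∑[ p ∈ V ] ∑[ q ∈ V ] ∑[ r ∈ V ] (δ (q , r) * W p q r)
        - ∑[ p ∈ V ] ∑[ q ∈ V ] ∑[ r ∈ V ] (δ (p , r) * W p q r)
        ≡⟨ cong₂ _-_ (cong₂ _+_ first-edge second-edge) third-edge ⟩
      ∑[ z ∈ V ] W x y z + ∑[ z ∈ V ] W z x y - ∑[ z ∈ V ] W x z y
        ≡⟨ sym (∑-distrib-+- V _ _ _) ⟩
      ∑[ z ∈ V ] (W x y z + W z x y - W x z y) ∎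
      where
      open ≡-Reasoning
      W = onTriangle F
      δ : ℕ × ℕ → ℤ
      δ e = ⟦ (x , y) ≐ e ⟧
      collapse : ∀ (K : ℕ → ℕ → ℤ) → ∑[ u ∈ V ] ∑[ v ∈ V ] (δ (u , v) * K u v) ≡ K x y
      collapse K = ∑∑-collapse δ K x∈V y∈V (⟦≐⟧-refl (x , y)) (λ ne → ⟦≐⟧-≢ (ne ∘ sym))
      first-edge : ∑[ p ∈ V ] ∑[ q ∈ V ] ∑[ r ∈ V ] (δ (p , q) * W p q r) ≡ ∑[ z ∈ V ] W x y z
      first-edge = trans (∑-cong V (λ {p} _ → ∑-cong V (λ {q} _ → ∑-*ˡ V (δ (p , q)) (W p q))))
                         (collapse (λ p q → ∑ V (W p q)))
      second-edge : ∑[ p ∈ V ] ∑[ q ∈ V ] ∑[ r ∈ V ] (δ (q , r) * W p q r) ≡ ∑[ z ∈ V ] W z x y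
      second-edge = ∑-cong V (λ {p} _ → collapse (W p))
      third-edge : ∑[ p ∈ V ] ∑[ q ∈ V ] ∑[ r ∈ V ] (δ (p , r) * W p q r) ≡ ∑[ z ∈ V ] W x z y
      third-edge =
        trans (∑-cong V (λ {p} _ → trans (∑-comm V V (λ q r → δ (p , r) * W p q r))
                                         (∑-cong V (λ {r} _ → ∑-*ˡ V (δ (p , r)) (λ q → W p q r)))))
              (collapse (λ p r → ∑[ q ∈ V ] W p q r))

  -- Columns of δ₁ at clique edges

  module CliqueEdge (c b : ℕ) {i j : ℕ} (i<j : i < j) (j≤c : j ≤ c) where
    open Graph c b

    f : ℕ × ℕ
    f = i , j

    χ : ℕ → ℕ → ℤ
    χ u v = ⟦ f ≐ (u , v) ⟧

    χ-descending : ∀ {u v} → v < u → χ u v ≡ 0ℤ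
    χ-descending v<u =
      ⟦≐⟧-≢ (λ f≡uv → ℕ.<-asym i<j (subst₂ _<_ (sym (cong proj₂ f≡uv)) (sym (cong proj₁ f≡uv)) v<u))

    incidence-χ : ∀ {p q r} → p < q → q < r → incidence (p , q , r) f ≡ χ p q + χ q r - χ p r
    incidence-χ p<q q<r = incidence-≐ f (ℕ.<⇒≢ p<q) (ℕ.<⇒≢ q<r)

    χ-sum≡δalt : ∀ {p q r} → p < q → q < r → χ p q + χ q r - χ p r ≡ δalt χ p q r
    χ-sum≡δalt {p} {q} {r} p<q q<r = begin
      χ p q + χ q r - χ p r
        ≡⟨ ring (χ p q) (χ q r) (χ p r) ⟩
      (χ p q - 0ℤ) + (χ q r - 0ℤ) - (χ p r - 0ℤ)
        ≡⟨ cong₂ _-_ (cong₂ _+_ (cong (_-_ (χ p q)) (χ-descending p<q))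
                                (cong (_-_ (χ q r)) (χ-descending q<r)))
                     (cong (_-_ (χ p r)) (χ-descending (ℕ.<-trans p<q q<r))) ⟨
      δalt χ p q r ∎
      where
      open ≡-Reasoning
      ring : ∀ a b c → a + b - c ≡ (a - 0ℤ) + (b - 0ℤ) - (c - 0ℤ)
      ring = solve-∀

    incidence≡δalt : ∀ {p q r} → p < q → q < r → incidence (p , q , r) f ≡ δalt χ p q r
    incidence≡δalt p<q q<r = trans (incidence-χ p<q q<r) (χ-sum≡δalt p<q q<r)

    clique-endpoints : ∀ {u v} → T (f ≐ (u , v)) → u ≤ c × v ≤ c
    clique-endpoints {u} {v} f≐uv = let f≡uv = ≐⇒≡ f (u , v) f≐uv in
      subst (_≤ c) (cong proj₁ f≡uv) (ℕ.≤-trans (ℕ.<⇒≤ i<j) j≤c) , subst (_≤ c) (cong proj₂ f≡uv) j≤c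

    entry : ℕ → ℕ → ℕ → ℤ
    entry = onTriangle (λ t → incidence t f)

    entry≡δalt : ∀ {p q r} → p ∈ V → q ∈ V → r ∈ V → entry p q r ≡ ⟦ ordered p q r ⟧ * δalt χ p q r
    entry≡δalt {p} {q} {r} p∈V q∈V r∈V with T? (ordered p q r)
    ... | no ¬o = trans (cong (_* incidence (p , q , r) f) (⟦⟧-false (¬o ∘ triangle⇒ordered)))
                        (sym (cong (_* δalt χ p q r) (⟦⟧-false ¬o)))
      where
      triangle⇒ordered : T (isTriangle c b (p , q , r)) → T (ordered p q r)
      triangle⇒ordered t = let p<q , q<r = triangle⇒< p q r t in <⇒ordered p<q q<r
    ... | yes o = begin
      Δ * incidence (p , q , r) f         ≡⟨ cong (Δ *_) (incidence-χ p<q q<r) ⟩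
      Δ * (χ p q + χ q r - χ p r)         ≡⟨ ring Δ (χ p q) (χ q r) (χ p r) ⟩
      Δ * χ p q + Δ * χ q r - Δ * χ p r   ≡⟨ cong₂ _-_ (cong₂ _+_ (⟦⟧-absorb (present ∘ inj₁ ∘ ends))
                                                              (⟦⟧-absorb (present ∘ inj₂ ∘ inj₁ ∘ ends)))
                                                   (⟦⟧-absorb (present ∘ inj₂ ∘ inj₂ ∘ ends)) ⟩
      χ p q + χ q r - χ p r               ≡⟨ χ-sum≡δalt p<q q<r ⟩
      δalt χ p q r                        ≡⟨ ℤ.*-identityˡ _ ⟨
      1ℤ * δalt χ p q r                   ≡⟨ cong (_* δalt χ p q r) (⟦⟧-true o) ⟨
      ⟦ ordered p q r ⟧ * δalt χ p q r    ∎
      where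
      open ≡-Reasoning
      Δ = ⟦ isTriangle c b (p , q , r) ⟧
      p<q = proj₁ (ordered⇒< p q r o)
      q<r = proj₂ (ordered⇒< p q r o)
      ring : ∀ d a b c → d * (a + b - c) ≡ d * a + d * b - d * c
      ring = solve-∀
      -- χ u v ≠ 0 forces (u , v) = f, and every ordered triple through f is a triangle.
      present : (p ≤ c × q ≤ c) ⊎ (q ≤ c × r ≤ c) ⊎ (p ≤ c × r ≤ c) → T (isTriangle c b (p , q , r))
      present = clique-triangle p∈V q∈V r∈V p<q q<r
      ends = clique-endpoints

    link-term≡δalt : ∀ {x y z} → x < y → x ∈ V → y ∈ V → z ∈ V →
                     entry x y z + entry z x y - entry x z y ≡ δalt χ x y z
    link-term≡δalt {x} {y} {z} x<y x∈V y∈V z∈V = begin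
      entry x y z + entry z x y - entry x z y
        ≡⟨ cong₂ _-_ (cong₂ _+_ (entry≡δalt x∈V y∈V z∈V) (entry≡δalt z∈V x∈V y∈V)) (entry≡δalt x∈V z∈V y∈V) ⟩
      ⟦ ordered x y z ⟧ * ε + ⟦ ordered z x y ⟧ * δalt χ z x y - ⟦ ordered x z y ⟧ * δalt χ x z y
        ≡⟨ cong₂ _-_ (cong (_+_ (⟦ ordered x y z ⟧ * ε)) (cong (⟦ ordered z x y ⟧ *_) (δalt-rotate χ x y z)))
                     (cong (⟦ ordered x z y ⟧ *_) (δalt-swap χ x y z)) ⟩
      ⟦ ordered x y z ⟧ * ε + ⟦ ordered z x y ⟧ * ε - ⟦ ordered x z y ⟧ * - ε
        ≡⟨ ring ⟦ ordered x y z ⟧ ⟦ ordered z x y ⟧ ⟦ ordered x z y ⟧ ε ⟩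
      s * ε
        ≡⟨ one-position ⟩
      ε ∎
      where
      open ≡-Reasoning
      ε = δalt χ x y z
      s = ⟦ ordered x y z ⟧ + ⟦ ordered z x y ⟧ + ⟦ ordered x z y ⟧
      ring : ∀ a b c e → a * e + b * e - c * - e ≡ (a + b + c) * e
      ring = solve-∀
      vanishes : ε ≡ 0ℤ → s * ε ≡ ε
      vanishes ε≡0 = trans (cong (s *_) ε≡0) (trans (ℤ.*-zeroʳ s) (sym ε≡0))
      one-position : s * ε ≡ ε
      one-position with z ℕ.≟ x | z ℕ.≟ y
      ... | yes refl | _        = vanishes (δalt-diagˡ χ x y)
      ... | no  _    | yes refl = vanishes (δalt-diagʳ χ x y)
      ... | no  z≢x  | no  z≢y  = trans (cong (_* ε) (exactly-one-position x<y z≢x z≢y)) (ℤ.*-identityˡ ε)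

    downLaplacian-eigen : ∀ {p q r} → T (isTriangle c b (p , q , r)) →
      ∑[ t ∈ triangleList c b ]
        (∑[ e ∈ edgeList c b ] (incidence (p , q , r) e * incidence t e) * incidence t f)
        ≡ + (b ℕ.+ c) * incidence (p , q , r) f
    downLaplacian-eigen {p} {q} {r} t = begin
      ∑[ t′ ∈ triangleList c b ]
        (∑[ e ∈ edgeList c b ] (incidence (p , q , r) e * incidence t′ e) * incidence t′ f)
        ≡⟨ ∑-∑-assoc (triangleList c b) (edgeList c b) (incidence (p , q , r)) incidence (flip incidence f) ⟩
      ∑[ e ∈ edgeList c b ] (incidence (p , q , r) e * M e)
        ≡⟨ ∑-edgeList-incidence M t ⟩
      M (p , q) + M (q , r) - M (p , r)
        ≡⟨ cong₂ _-_ (cong₂ _+_ (∑-triangleList-incidence _ p∈V q∈V) (∑-triangleList-incidence _ q∈V r∈V))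
                     (∑-triangleList-incidence _ p∈V r∈V) ⟩
      ∑[ z ∈ V ] G p q z + ∑[ z ∈ V ] G q r z - ∑[ z ∈ V ] G p r z
        ≡⟨ ∑-distrib-+- V _ _ _ ⟨
      ∑[ z ∈ V ] (G p q z + G q r z - G p r z)
        ≡⟨ ∑-cong V (λ z∈V → cong₂ _-_ (cong₂ _+_ (link-term≡δalt p<q p∈V q∈V z∈V)
                                                  (link-term≡δalt q<r q∈V r∈V z∈V))
                                       (link-term≡δalt (ℕ.<-trans p<q q<r) p∈V r∈V z∈V)) ⟩
      ∑[ z ∈ V ] (δalt χ p q z + δalt χ q r z - δalt χ p r z)
        ≡⟨ ∑-cong V (λ {z} _ → δalt-cocycle χ p q r z) ⟩
      ∑[ _ ∈ V ] δalt χ p q r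
        ≡⟨ ∑-const V _ ⟩
      + length V * δalt χ p q r
        ≡⟨ cong₂ (λ n e → + n * e) length-vertices (sym (incidence≡δalt p<q q<r)) ⟩
      + (b ℕ.+ c) * incidence (p , q , r) f ∎
      where
      open ≡-Reasoning
      M : ℕ × ℕ → ℤ
      M e = ∑[ t′ ∈ triangleList c b ] (incidence t′ e * incidence t′ f)
      G : ℕ → ℕ → ℕ → ℤ
      G x y z = entry x y z + entry z x y - entry x z y
      p<q = proj₁ (triangle⇒< p q r t)
      q<r = proj₂ (triangle⇒< p q r t)
      p∈V = proj₁ (triangle⇒∈ p q r t)
      q∈V = proj₁ (proj₂ (triangle⇒∈ p q r t))
      r∈V = proj₂ (proj₂ (triangle⇒∈ p q r t))

  IsCliqueEdge : ℕ → ℕ × ℕ → Set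
  IsCliqueEdge n (i , j) = 1 ≤ i × i < j × j ≤ n

  [1+n]C2≡n+nC2 : ∀ n → suc n C 2 ≡ n ℕ.+ n C 2
  [1+n]C2≡n+nC2 n = trans (sym (nCk+nC[k+1]≡[n+1]C[k+1] n 1)) (cong (ℕ._+ n C 2) (nC1≡n n))

  splitC2 : ∀ n → Fin (suc n C 2) → Fin n ⊎ Fin (n C 2)
  splitC2 n k = splitAt n (cast ([1+n]C2≡n+nC2 n) k)

  splitC2-injective : ∀ n {k k′} → splitC2 n k ≡ splitC2 n k′ → k ≡ k′
  splitC2-injective n {k} {k′} eq = Fin.toℕ-injective (begin
    toℕ k                               ≡⟨ Fin.toℕ-cast e k ⟨
    toℕ (cast e k)                      ≡⟨ cong toℕ (Fin.join-splitAt n (n C 2) (cast e k)) ⟨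
    toℕ (join n (n C 2) (splitC2 n k))  ≡⟨ cong (toℕ ∘ join n (n C 2)) eq ⟩
    toℕ (join n (n C 2) (splitC2 n k′)) ≡⟨ cong toℕ (Fin.join-splitAt n (n C 2) (cast e k′)) ⟩
    toℕ (cast e k′)                     ≡⟨ Fin.toℕ-cast e k′ ⟩
    toℕ k′                              ∎)
    where
    open ≡-Reasoning
    e = [1+n]C2≡n+nC2 n

  edgeToTop : ∀ n → Fin n → ℕ × ℕ
  edgeToTop n a = suc (toℕ a) , suc n

  -- The edges of the clique on {1, …, n+1} are those ending in n+1, followed by those of {1, …, n}.
  cliqueEdge : ∀ n → Fin (n C 2) → ℕ × ℕ
  cliqueEdge zero    ()
  cliqueEdge (suc n) k = [ edgeToTop n , cliqueEdge n ]′ (splitC2 n k)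

  cliqueEdge-valid : ∀ n k → IsCliqueEdge n (cliqueEdge n k)
  cliqueEdge-valid (suc n) k = valid (splitC2 n k)
    where
    valid : ∀ s → IsCliqueEdge (suc n) ([ edgeToTop n , cliqueEdge n ]′ s)
    valid (inj₁ a) = s≤s z≤n , s≤s (Fin.toℕ<n a) , ℕ.≤-refl
    valid (inj₂ k) = let 1≤i , i<j , j≤n = cliqueEdge-valid n k in 1≤i , i<j , ℕ.m≤n⇒m≤1+n j≤n

  cliqueEdge-injective : ∀ n {k k′} → cliqueEdge n k ≡ cliqueEdge n k′ → k ≡ k′
  cliqueEdge-injective (suc n) {k} {k′} eq = splitC2-injective n (injective (splitC2 n k) (splitC2 n k′) eq)
    where
    top≢old : ∀ a k → edgeToTop n a ≢ cliqueEdge n k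
    top≢old a k eq = ℕ.<-irrefl (sym (cong proj₂ eq)) (s≤s (proj₂ (proj₂ (cliqueEdge-valid n k))))
    injective : ∀ s s′ → [ edgeToTop n , cliqueEdge n ]′ s ≡ [ edgeToTop n , cliqueEdge n ]′ s′ → s ≡ s′
    injective (inj₁ a) (inj₁ a′) eq = cong inj₁ (Fin.toℕ-injective (ℕ.suc-injective (cong proj₁ eq)))
    injective (inj₁ a) (inj₂ k)  eq = ⊥-elim (top≢old a k eq)
    injective (inj₂ k) (inj₁ a)  eq = ⊥-elim (top≢old a k (sym eq))
    injective (inj₂ k) (inj₂ k′) eq = cong inj₂ (cliqueEdge-injective n eq)

  module Eigenvectors (c b : ℕ) (1≤b : 1 ≤ b) where
    open Graph c b

    edge : Fin (c C 2) → ℕ × ℕ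
    edge = cliqueEdge c

    eigenvector : Fin (c C 2) → TriVec c b
    eigenvector k t = fromℤ (incidence (lookup (triangleList c b) t) (edge k))

    eigenvector-inEigenspace : ∀ k → InEigenspace c b (fromℤ (+ (b ℕ.+ c))) (eigenvector k)
    eigenvector-inEigenspace k t = begin
      sumℚ (nTri c b) (λ t′ → fromℤ (downLaplacian c b t t′) ℚ.* eigenvector k t′)
        ≡⟨ sumℚ-fromℤ-* (nTri c b) (downLaplacian c b t) (λ t′ → incidence (lookup TL t′) (edge k)) ⟩
      fromℤ (sumℤ (nTri c b) (λ t′ → downLaplacian c b t t′ * incidence (lookup TL t′) (edge k)))
        ≡⟨ cong fromℤ (sumℤ-downLaplacian t (λ t′ → incidence t′ (edge k))) ⟩
      fromℤ (∑[ t′ ∈ TL ] (∑[ e ∈ edgeList c b ] (row e * incidence t′ e) * incidence t′ (edge k)))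
        ≡⟨ cong fromℤ (downLaplacian-eigen (lookup-triangleList t)) ⟩
      fromℤ (+ (b ℕ.+ c) * row (edge k))
        ≡⟨ fromℤ-* (+ (b ℕ.+ c)) _ ⟨
      fromℤ (+ (b ℕ.+ c)) ℚ.* eigenvector k t ∎
      where
      open ≡-Reasoning
      open CliqueEdge c b (proj₁ (proj₂ (cliqueEdge-valid c k))) (proj₂ (proj₂ (cliqueEdge-valid c k)))
        using (downLaplacian-eigen)
      TL = triangleList c b
      row = incidence (lookup TL t)

    apexTriangle : Fin (c C 2) → ℕ × ℕ × ℕ
    apexTriangle k = proj₁ (edge k) , proj₂ (edge k) , suc c

    apexTriangle-isTriangle : ∀ k → T (isTriangle c b (apexTriangle k))
    apexTriangle-isTriangle k = clique-triangle i∈V j∈V apex∈V i<j (s≤s j≤c) (inj₁ (i≤c , j≤c))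
      where
      1≤i = proj₁ (cliqueEdge-valid c k)
      i<j = proj₁ (proj₂ (cliqueEdge-valid c k))
      j≤c = proj₂ (proj₂ (cliqueEdge-valid c k))
      i≤c = ℕ.≤-trans (ℕ.<⇒≤ i<j) j≤c
      c≤N = ℕ.m≤n+m c b
      i∈V = ∈-vertices⁺ 1≤i (ℕ.≤-trans i≤c c≤N)
      j∈V = ∈-vertices⁺ (ℕ.≤-trans 1≤i (ℕ.<⇒≤ i<j)) (ℕ.≤-trans j≤c c≤N)
      apex∈V = ∈-vertices⁺ (s≤s z≤n) (ℕ.+-monoˡ-≤ c 1≤b)

    apex : Fin (c C 2) → Fin (nTri c b)
    apex k = Any.index (∈-triangleList {apexTriangle k} (apexTriangle-isTriangle k))

    eigenvector-apex : ∀ k m → eigenvector k (apex m) ≡ fromℤ ⟦ edge k ≐ edge m ⟧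
    eigenvector-apex k m = cong fromℤ (begin
      incidence (lookup (triangleList c b) (apex m)) (edge k)
        ≡⟨ cong (λ t → incidence t (edge k)) lookup-apex ⟩
      incidence (apexTriangle m) (edge k)
        ≡⟨ incidence-off-apex (edge k) (ℕ.<⇒≢ i<j) (ℕ.<⇒≢ (s≤s j≤c)) (λ y≡c+1 → ℕ.<-irrefl y≡c+1 (s≤s y≤c)) ⟩
      ⟦ edge k ≐ edge m ⟧ ∎)
      where
      open ≡-Reasoning
      i<j = proj₁ (proj₂ (cliqueEdge-valid c m))
      j≤c = proj₂ (proj₂ (cliqueEdge-valid c m))
      y≤c = proj₂ (proj₂ (cliqueEdge-valid c k))
      lookup-apex : lookup (triangleList c b) (apex m) ≡ apexTriangle m
      lookup-apex = sym (lookup-index (∈-triangleList {apexTriangle m} (apexTriangle-isTriangle m)))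

    eigenvector-independent : LinearlyIndependent c b (c C 2) eigenvector
    eigenvector-independent a combination≡0 m = begin
      a m                                                   ≡⟨ ℚ.*-identityʳ (a m) ⟨
      a m ℚ.* 1ℚ                                            ≡⟨ cong (a m ℚ.*_) at-own-apex ⟨
      a m ℚ.* eigenvector m (apex m)                        ≡⟨ sumℚ-select (c C 2) _ m off-own-apex ⟨
      sumℚ (c C 2) (λ k → a k ℚ.* eigenvector k (apex m))  ≡⟨ combination≡0 (apex m) ⟩
      0ℚ                                                    ∎
      where
      open ≡-Reasoning
      at-own-apex : eigenvector m (apex m) ≡ 1ℚ
      at-own-apex = trans (eigenvector-apex m m) (cong fromℤ (⟦≐⟧-refl (edge m)))
      off-own-apex : ∀ k → k ≢ m → a k ℚ.* eigenvector k (apex m) ≡ 0ℚ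
      off-own-apex k k≢m = begin
        a k ℚ.* eigenvector k (apex m)
          ≡⟨ cong (a k ℚ.*_) (eigenvector-apex k m) ⟩
        a k ℚ.* fromℤ ⟦ edge k ≐ edge m ⟧
          ≡⟨ cong (λ x → a k ℚ.* fromℤ x) (⟦≐⟧-≢ (k≢m ∘ cliqueEdge-injective c)) ⟩
        a k ℚ.* 0ℚ
          ≡⟨ ℚ.*-zeroʳ (a k) ⟩
        0ℚ ∎

open DownLaplacian using (module Eigenvectors)

open import Data.Fin using (Fin)
open import Data.Integer using (+_)
open import Data.Nat using (ℕ; _≤_; _+_)
open import Data.Nat.Combinatorics using (_C_)
open import Data.Product using (Σ; _×_; _,_)
open import Data.Rational using (_/_)

corollary3p23 : (c b : ℕ) → 3 ≤ c → 1 ≤ b →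
    Σ (Fin (c C 2) → TriVec c b) (λ vs →
      ((k : Fin (c C 2)) → InEigenspace c b ((+ (b + c)) / 1) (vs k))
      × LinearlyIndependent c b (c C 2) vs)
corollary3p23 c b _ 1≤b = eigenvector , eigenvector-inEigenspace , eigenvector-independent
  where open Eigenvectors c b 1≤b
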